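{- Let $p,p'$ be coprime with $1\le p<p'$, let $p'/p$ have continued fraction $[c_0,c_1,\ldots,c_n]$ with $c_0>1$, and let $y_k,z_k$ ($-1\le k\le n+1$), $\kappa_j,\tilde\kappa_j$ ($0\le j\le t$) be the associated parameters. Let $y'_k,z'_k,\kappa'_j,\tilde\kappa'_j$ be the corresponding parameters for $(p'-p)/p$, whose continued fraction is $[c_0-1,c_1,\ldots,c_n]$ (so its rank is $t-1$). Then $y_k=y'_k+z'_k$ and $z_k=z'_k$ for $0\le k\le n$, and $\kappa_j=\kappa'_{j-1}+\tilde\kappa'_{j-1}$ and $\tilde\kappa_j=\tilde\kappa'_{j-1}$ for $1\le j\le t$.
   Context: For coprime $1\le q<q'$, write $q'/q=c_0+1/(c_1+1/(\cdots+1/c_n))$ with $c_i\ge1$ for $i<n$ and $c_n\ge2$ (the continued fraction $[c_0,\ldots,c_n]$, with height $n$). Set $t_k=-1+\sum_{i=0}^{k-1}c_i$ for $0\le k\le n+1$ and rank $t=t_{n+1}-1=c_0+\cdots+c_n-2$. Define $y_{ -1}=0,y_0=1$, $z_{ -1}=1,z_0=0$ and $y_k=c_{k-1}y_{k-1}+y_{k-2}$, $z_k=c_{k-1}z_{k-1}+z_{k-2}$ for $1\le k\le n+1$ (so $y_{n+1}=q'$, $z_{n+1}=q$). For $0\le k\le n$ and $t_k<j\le t_{k+1}$ set $\kappa_j=y_{k-1}+(j-t_k)y_k$ (Takahashi lengths) and $\tilde\kappa_j=z_{k-1}+(j-t_k)z_k$ (truncated Takahashi lengths). -}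

module Defs where

open import Data.Nat using (ℕ; zero; suc; _+_; _*_; _∸_; _≤_; _<_; _<ᵇ_)
open import Data.Nat.Properties using (_<?_)
open import Data.Bool using (if_then_else_)
open import Data.List using (List; []; _∷_; length; take)
open import Data.Nat.ListAction using (sum)
open import Data.Product using (_×_; _,_; proj₁; proj₂; Σ)
open import Relation.Binary.PropositionalEquality using (_≡_)

-- A continued fraction [c₀, c₁, …, cₙ] is represented by its head c₀
-- and the list cs = [c₁, …, cₙ]; so its height is n = length cs.

-- c_i (0-based), with default 0 outside the range 0..n
cAt : ℕ → List ℕ → ℕ → ℕ
cAt c cs zero = c
cAt c [] (suc i) = 0
cAt c (d ∷ ds) (suc i) = cAt d ds i

height : ℕ → List ℕ → ℕ
height c cs = length cs

ValidCF : ℕ → List ℕ → Set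
ValidCF c [] = 2 ≤ c
ValidCF c (d ∷ ds) = (1 ≤ c) × ValidCF d ds

-- Value of [c₀,…,cₙ] as a fraction (numerator , denominator):
-- [c] = c/1 and [c, rest] = c + 1/[rest].
cfFrac : ℕ → List ℕ → ℕ × ℕ
cfFrac c [] = (c , 1)
cfFrac c (d ∷ ds) with cfFrac d ds
... | (a , b) = (c * a + b , a)

HasCF : ℕ → ℕ → ℕ → List ℕ → Set
HasCF q' q c cs = ValidCF c cs × (q' * proj₂ (cfFrac c cs) ≡ proj₁ (cfFrac c cs) * q)

-- Generic second-order recurrence s_k = c_{k-1} s_{k-1} + s_{k-2}
-- with initial values s_{-1} = a, s_0 = b.
-- recPair a b c cs k = (s_{k-1} , s_k)   for k ≥ 0.
recPair : ℕ → ℕ → ℕ → List ℕ → ℕ → ℕ × ℕ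
recPair a b c cs zero = (a , b)
recPair a b c cs (suc k) with recPair a b c cs k
... | (u , v) = (v , cAt c cs k * v + u)

yK : ℕ → List ℕ → ℕ → ℕ
yK c cs k = proj₂ (recPair 0 1 c cs k)

zK : ℕ → List ℕ → ℕ → ℕ
zK c cs k = proj₂ (recPair 1 0 c cs k)

-- y_{k-1}, z_{k-1} for k ≥ 0 (so yPrev … 0 = y_{-1} = 0).
yPrev : ℕ → List ℕ → ℕ → ℕ
yPrev c cs k = proj₁ (recPair 0 1 c cs k)

zPrev : ℕ → List ℕ → ℕ → ℕ
zPrev c cs k = proj₁ (recPair 1 0 c cs k)

-- T k = t_k + 1 = c_0 + ⋯ + c_{k-1}  (shifted to stay in ℕ, since t_0 = -1).
Tsh : ℕ → List ℕ → ℕ → ℕ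
Tsh c cs k = sum (take k (c ∷ cs))

rank : ℕ → List ℕ → ℕ
rank c cs = sum (c ∷ cs) ∸ 2

-- level c cs j = the k with t_k < j ≤ t_{k+1}, i.e. T_k ≤ j < T_{k+1}
-- (for j in range 0 ≤ j ≤ t; out-of-range j are sent to level n).
level : ℕ → List ℕ → ℕ → ℕ
level c [] j = 0
level c (d ∷ ds) j = if j <ᵇ c then 0 else suc (level d ds (j ∸ c))

-- κ_j = y_{k-1} + (j - t_k) y_k,  with j - t_k = j + 1 - T_k.
kappa : ℕ → List ℕ → ℕ → ℕ
kappa c cs j = yPrev c cs k + (suc j ∸ Tsh c cs k) * yK c cs k
  where k = level c cs j

kappaT : ℕ → List ℕ → ℕ → ℕ
kappaT c cs j = zPrev c cs k + (suc j ∸ Tsh c cs k) * zK c cs k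
  where k = level c cs j

{-# OPTIONS --safe #-}
module Submission where

open import Defs
open import Data.Nat using (ℕ; zero; suc; _+_; _*_; _∸_; _≤_; _<_)
open import Data.Nat.Properties using (*-zeroʳ)
open import Data.Nat.Tactic.RingSolver using (solve-∀)
open import Data.Nat.Coprimality using (Coprime)
open import Data.List using (List; []; _∷_; length)
open import Data.Product using (_×_; _,_; proj₁; proj₂; zip′)
open import Relation.Binary.PropositionalEquality
  using (_≡_; refl; sym; trans; cong; cong₂; module ≡-Reasoning)

-- The pair (s_{k-1}, s_k) of a solution of s_k = c_{k-1} s_{k-1} + s_{k-2} depends
-- linearly on the initial values (s_{-1}, s_0), and c₀ enters only through the first
-- step, where (c₀ + 1, s_{-1}, s_0) gives the same (s_0, s_1) as (c₀, s_{-1} + s_0, s_0).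
-- So from k = 1 on, raising c₀ by one turns y into the solution with initial values
-- (1, 1) = (0, 1) + (1, 0), i.e. into y + z, and leaves z unchanged.  Index j + 1 for
-- c₀ + 1 lies at the same level as j for c₀, with the same multiplier j − t_k except
-- at level 0, so κ and κ̃, being linear in these pairs, follow.

infixl 6 _⊕_

_⊕_ : ℕ × ℕ → ℕ × ℕ → ℕ × ℕ
_⊕_ = zip′ _+_ _+_

next : ℕ → ℕ × ℕ → ℕ × ℕ
next a (u , v) = (v , a * v + u)

next-⊕ : ∀ a P Q → next a (P ⊕ Q) ≡ next a P ⊕ next a Q
next-⊕ a (u , v) (u′ , v′) = cong (v + v′ ,_) (distrib a v v′ u u′)
  where
  distrib : ∀ a v v′ u u′ → a * (v + v′) + (u + u′) ≡ (a * v + u) + (a * v′ + u′)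
  distrib = solve-∀

recPair-suc : ∀ a b c cs k → recPair a b c cs (suc k) ≡ next (cAt c cs k) (recPair a b c cs k)
recPair-suc a b c cs k with recPair a b c cs k
... | _ , _ = refl

recPair-⊕ : ∀ a b a′ b′ c cs k →
  recPair (a + a′) (b + b′) c cs k ≡ recPair a b c cs k ⊕ recPair a′ b′ c cs k
recPair-⊕ a b a′ b′ c cs zero = refl
recPair-⊕ a b a′ b′ c cs (suc k) = begin
  recPair (a + a′) (b + b′) c cs (suc k)
    ≡⟨ recPair-suc (a + a′) (b + b′) c cs k ⟩
  next cₖ (recPair (a + a′) (b + b′) c cs k)
    ≡⟨ cong (next cₖ) (recPair-⊕ a b a′ b′ c cs k) ⟩
  next cₖ (recPair a b c cs k ⊕ recPair a′ b′ c cs k)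
    ≡⟨ next-⊕ cₖ (recPair a b c cs k) (recPair a′ b′ c cs k) ⟩
  next cₖ (recPair a b c cs k) ⊕ next cₖ (recPair a′ b′ c cs k)
    ≡⟨ sym (cong₂ _⊕_ (recPair-suc a b c cs k) (recPair-suc a′ b′ c cs k)) ⟩
  recPair a b c cs (suc k) ⊕ recPair a′ b′ c cs (suc k) ∎
  where
  open ≡-Reasoning
  cₖ = cAt c cs k

cAt-suc-irrelevant : ∀ c c′ cs i → cAt c cs (suc i) ≡ cAt c′ cs (suc i)
cAt-suc-irrelevant c c′ []       i = refl
cAt-suc-irrelevant c c′ (d ∷ ds) i = refl

recPair-suc-cong : ∀ {a b c a′ b′ c′} cs → next c (a , b) ≡ next c′ (a′ , b′) →
  ∀ k → recPair a b c cs (suc k) ≡ recPair a′ b′ c′ cs (suc k)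
recPair-suc-cong cs first zero = first
recPair-suc-cong {a} {b} {c} {a′} {b′} {c′} cs first (suc k) = begin
  recPair a b c cs (suc (suc k))
    ≡⟨ recPair-suc a b c cs (suc k) ⟩
  next (cAt c cs (suc k)) (recPair a b c cs (suc k))
    ≡⟨ cong₂ next (cAt-suc-irrelevant c c′ cs k) (recPair-suc-cong cs first k) ⟩
  next (cAt c′ cs (suc k)) (recPair a′ b′ c′ cs (suc k))
    ≡⟨ sym (recPair-suc a′ b′ c′ cs (suc k)) ⟩
  recPair a′ b′ c′ cs (suc (suc k)) ∎
  where open ≡-Reasoning

recPair-suc-head : ∀ a b c cs k → recPair a b (suc c) cs (suc k) ≡ recPair (b + a) b c cs (suc k)
recPair-suc-head a b c cs = recPair-suc-cong cs (cong (b ,_) (shift b c a))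
  where
  shift : ∀ b c a → suc c * b + a ≡ c * b + (b + a)
  shift = solve-∀

yzPair-suc-head : ∀ c cs k →
  recPair 0 1 (suc c) cs (suc k) ≡ recPair 0 1 c cs (suc k) ⊕ recPair 1 0 c cs (suc k)
yzPair-suc-head c cs k = trans (recPair-suc-head 0 1 c cs k) (recPair-⊕ 0 1 1 0 c cs (suc k))

zPair-suc-head : ∀ c cs k → recPair 1 0 (suc c) cs (suc k) ≡ recPair 1 0 c cs (suc k)
zPair-suc-head = recPair-suc-head 1 0

yK-suc-head : ∀ c cs k → yK (suc c) cs k ≡ yK c cs k + zK c cs k
yK-suc-head c cs zero    = refl
yK-suc-head c cs (suc k) = cong proj₂ (yzPair-suc-head c cs k)

zK-suc-head : ∀ c cs k → zK (suc c) cs k ≡ zK c cs k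
zK-suc-head c cs zero    = refl
zK-suc-head c cs (suc k) = cong proj₂ (zPair-suc-head c cs k)

-- kappa c cs j and kappaT c cs j unfold to takahashi of the y- and z-pair at level j.
takahashi : ℕ × ℕ → ℕ → ℕ
takahashi (u , v) m = u + m * v

takahashi-⊕ : ∀ P Q m → takahashi (P ⊕ Q) m ≡ takahashi P m + takahashi Q m
takahashi-⊕ (u , v) (u′ , v′) m = distrib u u′ m v v′
  where
  distrib : ∀ u u′ m v v′ → (u + u′) + m * (v + v′) ≡ (u + m * v) + (u′ + m * v′)
  distrib = solve-∀

level-suc-head : ∀ c cs i → level (suc c) cs (suc i) ≡ level c cs i
level-suc-head c []       i = refl
level-suc-head c (d ∷ ds) i = refl

-- Tsh (suc c) cs (suc k) reduces to suc (Tsh c cs (suc k)), so from level 1 on the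
-- multipliers j − t_k agree.
takahashi-y-suc-head : ∀ c cs i k →
  takahashi (recPair 0 1 (suc c) cs k) (suc (suc i) ∸ Tsh (suc c) cs k)
    ≡ takahashi (recPair 0 1 c cs k) (suc i ∸ Tsh c cs k)
      + takahashi (recPair 1 0 c cs k) (suc i ∸ Tsh c cs k)
takahashi-y-suc-head c cs i zero = level0 i
  where
  level0 : ∀ i → suc (suc i) * 1 ≡ suc i * 1 + (1 + suc i * 0)
  level0 = solve-∀
takahashi-y-suc-head c cs i (suc k) =
  trans (cong (λ P → takahashi P m) (yzPair-suc-head c cs k))
        (takahashi-⊕ (recPair 0 1 c cs (suc k)) (recPair 1 0 c cs (suc k)) m)
  where m = suc i ∸ Tsh c cs (suc k)

takahashi-z-suc-head : ∀ c cs i k →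
  takahashi (recPair 1 0 (suc c) cs k) (suc (suc i) ∸ Tsh (suc c) cs k)
    ≡ takahashi (recPair 1 0 c cs k) (suc i ∸ Tsh c cs k)
takahashi-z-suc-head c cs i zero    = cong suc (trans (*-zeroʳ (suc (suc i))) (sym (*-zeroʳ (suc i))))
takahashi-z-suc-head c cs i (suc k) =
  cong (λ P → takahashi P (suc i ∸ Tsh c cs (suc k))) (zPair-suc-head c cs k)

kappa-suc-head : ∀ c cs i → kappa (suc c) cs (suc i) ≡ kappa c cs i + kappaT c cs i
kappa-suc-head c cs i rewrite level-suc-head c cs i = takahashi-y-suc-head c cs i (level c cs i)

kappaT-suc-head : ∀ c cs i → kappaT (suc c) cs (suc i) ≡ kappaT c cs i
kappaT-suc-head c cs i rewrite level-suc-head c cs i = takahashi-z-suc-head c cs i (level c cs i)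

lemmaE1 : (p p' c₀ : ℕ) (cs : List ℕ) →
    Coprime p p' → 1 ≤ p → p < p' →
    HasCF p' p c₀ cs → 1 < c₀ →
    ((k : ℕ) → k ≤ length cs →
      (yK c₀ cs k ≡ yK (c₀ ∸ 1) cs k + zK (c₀ ∸ 1) cs k) × (zK c₀ cs k ≡ zK (c₀ ∸ 1) cs k))
    × ((j : ℕ) → 1 ≤ j → j ≤ rank c₀ cs →
      (kappa c₀ cs j ≡ kappa (c₀ ∸ 1) cs (j ∸ 1) + kappaT (c₀ ∸ 1) cs (j ∸ 1))
      × (kappaT c₀ cs j ≡ kappaT (c₀ ∸ 1) cs (j ∸ 1)))
lemmaE1 p p' zero    cs _ _ _ _ ()
lemmaE1 p p' (suc c) cs _ _ _ _ _ =
  (λ k _ → yK-suc-head c cs k , zK-suc-head c cs k) ,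
  λ { (suc i) _ _ → kappa-suc-head c cs i , kappaT-suc-head c cs i }
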